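{- If a d-sequent $!\Xi;\Gamma\Rightarrow C$ is derivable in $!_{\mathrm d}\mathbf{ACT}_\omega^{\mathrm m}$, then so is $!\Xi\cup!\Xi';\Gamma\Rightarrow C$ for every finite set $!\Xi'$ of formulas of the form $!B$ with $B$ a monoidal implication.
   Context: Formulas are built from a countable set of variables and constants $0,1$ using binary $\backslash$, $/$, $\cdot$, $\oplus$, $\&$, unary postfix ${}^*$ and unary prefix $!$. A monoidal implication is a formula $(b_1\cdot\ldots\cdot b_n)\backslash(c_1\cdot\ldots\cdot c_m)$ with $n,m\ge0$ and $b_i,c_j$ variables (an empty product stands for $1$). Only formulas in which every subformula of the form $!B$ has $B$ a monoidal implication are considered. A d-sequent is $!\Xi;\Gamma\Rightarrow C$ with $C$ a formula, $\Gamma$ a finite (possibly empty) sequence of formulas, and $!\Xi$ a finite set of formulas $!B$ with $B$ a monoidal implication. $A^n$ denotes $n$ copies of $A$. The calculus $!_{\mathrm d}\mathbf{ACT}_\omega^{\mathrm m}$ (same $!\Xi$ in all premises and conclusion unless displayed otherwise): axioms $!\Xi;A\Rightarrow A$; $!\Xi;\ \Rightarrow1$; $!\Xi;\Gamma,0,\Delta\Rightarrow C$; $!\Xi;\ \Rightarrow A^*$. Rules (premises / conclusion): ($\backslash L$) $!\Xi;\Pi\Rightarrow A$, $!\Xi;\Gamma,B,\Delta\Rightarrow C$ / $!\Xi;\Gamma,\Pi,A\backslash B,\Delta\Rightarrow C$; ($\backslash R$) $!\Xi;A,\Pi\Rightarrow B$ / $!\Xi;\Pi\Rightarrow A\backslash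 B$; ($/L$) $!\Xi;\Pi\Rightarrow A$, $!\Xi;\Gamma,B,\Delta\Rightarrow C$ / $!\Xi;\Gamma,B/A,\Pi,\Delta\Rightarrow C$; ($/R$) $!\Xi;\Pi,A\Rightarrow B$ / $!\Xi;\Pi\Rightarrow B/A$; ($\cdot L$) $!\Xi;\Gamma,A,B,\Delta\Rightarrow C$ / $!\Xi;\Gamma,A\cdot B,\Delta\Rightarrow C$; ($\cdot R$) $!\Xi;\Gamma\Rightarrow A$, $!\Xi;\Delta\Rightarrow B$ / $!\Xi;\Gamma,\Delta\Rightarrow A\cdot B$; ($1L$) $!\Xi;\Gamma,\Delta\Rightarrow C$ / $!\Xi;\Gamma,1,\Delta\Rightarrow C$; ($\oplus L$) $!\Xi;\Gamma,A_1,\Delta\Rightarrow C$, $!\Xi;\Gamma,A_2,\Delta\Rightarrow C$ / $!\Xi;\Gamma,A_1\oplus A_2,\Delta\Rightarrow C$; ($\oplus R_i$) $!\Xi;\Pi\Rightarrow A_i$ / $!\Xi;\Pi\Rightarrow A_1\oplus A_2$; ($\&L_i$) $!\Xi;\Gamma,A_i,\Delta\Rightarrow C$ / $!\Xi;\Gamma,A_1\&A_2,\Delta\Rightarrow C$; ($\&R$) $!\Xi;\Pi\Rightarrow A_1$, $!\Xi;\Pi\Rightarrow A_2$ / $!\Xi;\Pi\Rightarrow A_1\&A_2$; (${}^*L_\omega$) $(!\Xi;\Gamma,A^n,\Delta\Rightarrow C)_{n\in\omega}$ / $!\Xi;\Gamma,A^*,\Delta\Rightarrow C$; (${}^*R_n$,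 $n\ge1$) $!\Xi;\Pi_1\Rightarrow A,\dots,!\Xi;\Pi_n\Rightarrow A$ / $!\Xi;\Pi_1,\dots,\Pi_n\Rightarrow A^*$; $(!L)_{\mathrm d}$ $!\Xi\cup\{!A\};\Gamma,\Delta\Rightarrow C$ / $!\Xi;\Gamma,!A,\Delta\Rightarrow C$; $(!R)_{\mathrm d}$ $!\Xi;\ \Rightarrow B$ / $!\Xi;\ \Rightarrow!B$; $(A)_{\mathrm d}$ $!\Xi;\Gamma,c_1,\dots,c_m,\Delta\Rightarrow C$ / $\{!((b_1\cdot\ldots\cdot b_n)\backslash(c_1\cdot\ldots\cdot c_m))\}\cup!\Xi;\Gamma,b_1,\dots,b_n,\Delta\Rightarrow C$; $(\mathrm{Cut})_{\mathrm d1}$ $!\Xi;\Pi\Rightarrow A$, $!\Xi;\Gamma,A,\Delta\Rightarrow C$ / $!\Xi;\Gamma,\Pi,\Delta\Rightarrow C$; $(\mathrm{Cut})_{\mathrm d2}$ $!\Xi;\ \Rightarrow B$, $!\Xi\cup\{!B\};\Gamma\Rightarrow C$ / $!\Xi;\Gamma\Rightarrow C$. Derivable d-sequents form the least set containing the axioms and closed under the rules. -}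

module Defs where

open import Data.Nat using (ℕ)
open import Data.List using (List; []; _∷_; _++_; [_]; map; replicate; concat)
open import Data.List.Relation.Unary.All using (All)
open import Data.List.Relation.Binary.Subset.Propositional using (_⊆_)
open import Data.Product using (_×_)

Var : Set
Var = ℕ

-- A monoidal implication (b1·…·bn)\(c1·…·cm), given by its two lists of variables.
record MI : Set where
  constructor mi
  field
    lhs : List Var
    rhs : List Var

infixr 30 _·_
infixr 20 _⧵_
infixl 20 _／_
infixr 10 _⊕_ _&_
infix 40 _*

-- Formulas. The exponential ! is only applied to monoidal implications,
-- which builds the paper's restriction into the syntax.
data Formula : Set where
  var  : Var → Formula
  𝟘 𝟙  : Formula
  _⧵_  : Formula → Formula → Formula
  _／_  : Formula → Formula → Formula
  _·_  : Formula → Formula → Formula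
  _⊕_  : Formula → Formula → Formula
  _&_  : Formula → Formula → Formula
  _*   : Formula → Formula
  !_   : MI → Formula

prod : List Var → Formula
prod []           = 𝟙
prod (b ∷ [])     = var b
prod (b ∷ c ∷ bs) = var b · prod (c ∷ bs)

⌜_⌝ : MI → Formula
⌜ mi bs cs ⌝ = prod bs ⧵ prod cs

-- The set !Ξ is represented by a list of monoidal implications (ξ stands for {!B | B ∈ ξ}).
-- Set equality of such representations.
_≋_ : List MI → List MI → Set
ξ ≋ ζ = (ξ ⊆ ζ) × (ζ ⊆ ξ)

-- Derivability in !_d ACT_ω^m :  ⊢ ξ ; Γ ⇒ C
-- "{!A} ∪ !Ξ" is rendered as any list set-equal to (A ∷ Ξ).
infix 4 ⊢_︔_⇒_
data ⊢_︔_⇒_ (ξ : List MI) : List Formula → Formula → Set where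
  ax     : ∀ A → ⊢ ξ ︔ [ A ] ⇒ A
  1R     : ⊢ ξ ︔ [] ⇒ 𝟙
  0L     : ∀ Γ Δ C → ⊢ ξ ︔ Γ ++ 𝟘 ∷ Δ ⇒ C
  *ax    : ∀ A → ⊢ ξ ︔ [] ⇒ A *
  ⧵L     : ∀ {Π Γ Δ A B C} → ⊢ ξ ︔ Π ⇒ A → ⊢ ξ ︔ Γ ++ B ∷ Δ ⇒ C
           → ⊢ ξ ︔ Γ ++ Π ++ (A ⧵ B) ∷ Δ ⇒ C
  ⧵R     : ∀ {Π A B} → ⊢ ξ ︔ A ∷ Π ⇒ B → ⊢ ξ ︔ Π ⇒ A ⧵ B
  ／L     : ∀ {Π Γ Δ A B C} → ⊢ ξ ︔ Π ⇒ A → ⊢ ξ ︔ Γ ++ B ∷ Δ ⇒ C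
           → ⊢ ξ ︔ Γ ++ (B ／ A) ∷ Π ++ Δ ⇒ C
  ／R     : ∀ {Π A B} → ⊢ ξ ︔ Π ++ [ A ] ⇒ B → ⊢ ξ ︔ Π ⇒ B ／ A
  ·L     : ∀ {Γ Δ A B C} → ⊢ ξ ︔ Γ ++ A ∷ B ∷ Δ ⇒ C → ⊢ ξ ︔ Γ ++ (A · B) ∷ Δ ⇒ C
  ·R     : ∀ {Γ Δ A B} → ⊢ ξ ︔ Γ ⇒ A → ⊢ ξ ︔ Δ ⇒ B → ⊢ ξ ︔ Γ ++ Δ ⇒ A · B
  1L     : ∀ {Γ Δ C} → ⊢ ξ ︔ Γ ++ Δ ⇒ C → ⊢ ξ ︔ Γ ++ 𝟙 ∷ Δ ⇒ C
  ⊕L     : ∀ {Γ Δ A₁ A₂ C} → ⊢ ξ ︔ Γ ++ A₁ ∷ Δ ⇒ C → ⊢ ξ ︔ Γ ++ A₂ ∷ Δ ⇒ C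
           → ⊢ ξ ︔ Γ ++ (A₁ ⊕ A₂) ∷ Δ ⇒ C
  ⊕R₁    : ∀ {Π A₁ A₂} → ⊢ ξ ︔ Π ⇒ A₁ → ⊢ ξ ︔ Π ⇒ A₁ ⊕ A₂
  ⊕R₂    : ∀ {Π A₁ A₂} → ⊢ ξ ︔ Π ⇒ A₂ → ⊢ ξ ︔ Π ⇒ A₁ ⊕ A₂
  &L₁    : ∀ {Γ Δ A₁ A₂ C} → ⊢ ξ ︔ Γ ++ A₁ ∷ Δ ⇒ C → ⊢ ξ ︔ Γ ++ (A₁ & A₂) ∷ Δ ⇒ C
  &L₂    : ∀ {Γ Δ A₁ A₂ C} → ⊢ ξ ︔ Γ ++ A₂ ∷ Δ ⇒ C → ⊢ ξ ︔ Γ ++ (A₁ & A₂) ∷ Δ ⇒ C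
  &R     : ∀ {Π A₁ A₂} → ⊢ ξ ︔ Π ⇒ A₁ → ⊢ ξ ︔ Π ⇒ A₂ → ⊢ ξ ︔ Π ⇒ A₁ & A₂
  *Lω    : ∀ {Γ Δ A C} → (∀ n → ⊢ ξ ︔ Γ ++ replicate n A ++ Δ ⇒ C)
           → ⊢ ξ ︔ Γ ++ (A *) ∷ Δ ⇒ C
  *Rn    : ∀ {A} (Π : List Formula) (Πs : List (List Formula))
           → ⊢ ξ ︔ Π ⇒ A → All (λ P → ⊢ ξ ︔ P ⇒ A) Πs
           → ⊢ ξ ︔ concat (Π ∷ Πs) ⇒ A *
  !L     : ∀ {Γ Δ C} (m : MI) (ξ' : List MI) → ξ' ≋ (m ∷ ξ)
           → ⊢ ξ' ︔ Γ ++ Δ ⇒ C → ⊢ ξ ︔ Γ ++ (! m) ∷ Δ ⇒ C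
  !R     : ∀ (m : MI) → ⊢ ξ ︔ [] ⇒ ⌜ m ⌝ → ⊢ ξ ︔ [] ⇒ ! m
  Ad     : ∀ {Γ Δ C} (bs cs : List Var) (ζ : List MI) → ξ ≋ (mi bs cs ∷ ζ)
           → ⊢ ζ ︔ Γ ++ map var cs ++ Δ ⇒ C
           → ⊢ ξ ︔ Γ ++ map var bs ++ Δ ⇒ C
  Cut1   : ∀ {Π Γ Δ A C} → ⊢ ξ ︔ Π ⇒ A → ⊢ ξ ︔ Γ ++ A ∷ Δ ⇒ C
           → ⊢ ξ ︔ Γ ++ Π ++ Δ ⇒ C
  Cut2   : ∀ {Γ C} (m : MI) (ξ' : List MI) → ⊢ ξ ︔ [] ⇒ ⌜ m ⌝
           → ξ' ≋ (m ∷ ξ) → ⊢ ξ' ︔ Γ ⇒ C → ⊢ ξ ︔ Γ ⇒ C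

-- The only delicate rule is (A)_d, which removes the implication m it uses:
-- m is still in η, and since !-contexts are sets, η ≋ m ∷ η, so η itself
-- serves as the remaining context.
{-# OPTIONS --safe #-}
module Submission where

open import Defs
open import Data.List using (List; _++_; _∷_)
open import Data.List.Relation.Unary.All using (All; []; _∷_)
open import Data.List.Relation.Unary.Any using (here; there)
open import Data.List.Relation.Binary.Subset.Propositional using (_⊆_)
open import Data.List.Relation.Binary.Subset.Propositional.Properties
  using (⊆-refl; ⊆-trans; ∷⁺ʳ; xs⊆x∷xs; ∈-∷⁺ʳ; xs⊆xs++ys)
open import Data.List.Membership.Propositional using (_∈_)
open import Data.Product using (_,_)
open import Relation.Binary.PropositionalEquality using (refl)

≋-refl : ∀ {ξ} → ξ ≋ ξ
≋-refl = ⊆-refl , ⊆-refl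

∈⇒≋-∷ : ∀ {m η} → m ∈ η → η ≋ (m ∷ η)
∈⇒≋-∷ {m} {η} m∈η = xs⊆x∷xs η m , ∈-∷⁺ʳ m∈η ⊆-refl

mutual
  weaken : ∀ {ξ η Γ C} → ξ ⊆ η → ⊢ ξ ︔ Γ ⇒ C → ⊢ η ︔ Γ ⇒ C
  weaken ξ⊆η (ax A)          = ax A
  weaken ξ⊆η 1R              = 1R
  weaken ξ⊆η (0L Γ Δ C)      = 0L Γ Δ C
  weaken ξ⊆η (*ax A)         = *ax A
  weaken ξ⊆η (⧵L d e)        = ⧵L (weaken ξ⊆η d) (weaken ξ⊆η e)
  weaken ξ⊆η (⧵R d)          = ⧵R (weaken ξ⊆η d)
  weaken ξ⊆η (／L d e)        = ／L (weaken ξ⊆η d) (weaken ξ⊆η e)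
  weaken ξ⊆η (／R d)          = ／R (weaken ξ⊆η d)
  weaken ξ⊆η (·L d)          = ·L (weaken ξ⊆η d)
  weaken ξ⊆η (·R d e)        = ·R (weaken ξ⊆η d) (weaken ξ⊆η e)
  weaken ξ⊆η (1L d)          = 1L (weaken ξ⊆η d)
  weaken ξ⊆η (⊕L d e)        = ⊕L (weaken ξ⊆η d) (weaken ξ⊆η e)
  weaken ξ⊆η (⊕R₁ d)         = ⊕R₁ (weaken ξ⊆η d)
  weaken ξ⊆η (⊕R₂ d)         = ⊕R₂ (weaken ξ⊆η d)
  weaken ξ⊆η (&L₁ d)         = &L₁ (weaken ξ⊆η d)
  weaken ξ⊆η (&L₂ d)         = &L₂ (weaken ξ⊆η d)
  weaken ξ⊆η (&R d e)        = &R (weaken ξ⊆η d) (weaken ξ⊆η e)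
  weaken ξ⊆η (*Lω ds)        = *Lω (λ n → weaken ξ⊆η (ds n))
  weaken ξ⊆η (*Rn Π Πs d ds) = *Rn Π Πs (weaken ξ⊆η d) (weaken-All ξ⊆η ds)
  weaken {η = η} ξ⊆η (!L m ξ' (ξ'⊆m∷ξ , _) d) =
    !L m (m ∷ η) ≋-refl (weaken (⊆-trans ξ'⊆m∷ξ (∷⁺ʳ m ξ⊆η)) d)
  weaken ξ⊆η (!R m d)        = !R m (weaken ξ⊆η d)
  weaken {η = η} ξ⊆η (Ad {Γ} {Δ} bs cs ζ (_ , m∷ζ⊆ξ) d) =
    Ad {Γ = Γ} {Δ = Δ} bs cs η (∈⇒≋-∷ (ξ⊆η (m∷ζ⊆ξ (here refl))))
      (weaken (λ p → ξ⊆η (m∷ζ⊆ξ (there p))) d)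
  weaken ξ⊆η (Cut1 d e)      = Cut1 (weaken ξ⊆η d) (weaken ξ⊆η e)
  weaken {η = η} ξ⊆η (Cut2 m ξ' d (ξ'⊆m∷ξ , _) e) =
    Cut2 m (m ∷ η) (weaken ξ⊆η d) ≋-refl (weaken (⊆-trans ξ'⊆m∷ξ (∷⁺ʳ m ξ⊆η)) e)

  weaken-All : ∀ {ξ η A Πs} → ξ ⊆ η
    → All (λ Π → ⊢ ξ ︔ Π ⇒ A) Πs → All (λ Π → ⊢ η ︔ Π ⇒ A) Πs
  weaken-All ξ⊆η []       = []
  weaken-All ξ⊆η (d ∷ ds) = weaken ξ⊆η d ∷ weaken-All ξ⊆η ds

lemma3p2 : (ξ ξ' : List MI) (Γ : List Formula) (C : Formula)
    → ⊢ ξ ︔ Γ ⇒ C → ⊢ ξ ++ ξ' ︔ Γ ⇒ C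
lemma3p2 ξ ξ' Γ C = weaken (xs⊆xs++ys ξ ξ')
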